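{- Let $a,b$ be odd positive integers and $n$ a positive integer. Then $$t(a,a,2b,4b;n)=N(a,a,b,2b;4n+a+3b)-N\big(a,a,b,2b;2n+\tfrac{a+3b}2\big).$$
   Context: For positive integers $a_1,\dots,a_k$ and a nonnegative integer $n$, $N(a_1,\dots,a_k;n)$ is the number of $(x_1,\dots,x_k)\in\mathbb Z^k$ with $n=a_1x_1^2+\cdots+a_kx_k^2$, and $t(a_1,\dots,a_k;n)$ is the number of $(x_1,\dots,x_k)\in\mathbb Z^k$ with $n=a_1\frac{x_1(x_1-1)}2+\cdots+a_k\frac{x_k(x_k-1)}2$. -}

module Defs where

open import Data.Nat using (ℕ; zero; suc; _+_; _*_; _/_; _≟_)
open import Data.Integer as ℤ using (ℤ; +_; -[1+_])
open import Data.List using (List; []; _∷_; _++_; concatMap; length; filter; downFrom)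
open import Data.Product using (Σ; _×_; _,_)
open import Relation.Binary.PropositionalEquality using (_≡_)

Odd : ℕ → Set
Odd m = Σ ℕ (λ k → m ≡ 2 * k + 1)

box : ℕ → List ℤ
box B = + 0 ∷ concatMap (λ k → + suc k ∷ -[1+ k ] ∷ []) (downFrom B)

sq : ℤ → ℕ
sq x = ℤ.∣ x ℤ.* x ∣

-- triangular-type value x(x-1)/2 for integer x (x(x-1) ≥ 0 always)
tri : ℤ → ℕ
tri x = ℤ.∣ x ℤ.* (x ℤ.- + 1) ∣ / 2

box4 : ℕ → List (ℤ × ℤ × ℤ × ℤ)
box4 B = concatMap (λ x → concatMap (λ y → concatMap (λ z →
           concatMap (λ w → (x , y , z , w) ∷ []) (box B)) (box B)) (box B)) (box B)

countIn : (ℤ × ℤ × ℤ × ℤ → ℕ) → ℕ → ℕ → ℕ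
countIn f B n = length (filter (λ v → f v ≟ n) (box4 B))

-- N(a1,a2,a3,a4; n) = #{x ∈ ℤ⁴ : n = a1 x1² + ... + a4 x4²}.
-- For positive a_i every solution has |x_i| ≤ n, so counting in box [-n,n]⁴ is exact.
N4 : ℕ → ℕ → ℕ → ℕ → ℕ → ℕ
N4 a1 a2 a3 a4 n =
  countIn (λ { (x , y , z , w) → a1 * sq x + a2 * sq y + a3 * sq z + a4 * sq w }) n n

-- t(a1,a2,a3,a4; n) = #{x ∈ ℤ⁴ : n = Σ a_i x_i(x_i-1)/2}.
-- For positive a_i every solution has |x_i| ≤ n + 1, so counting in [-(n+1), n+1]⁴ is exact.
t4 : ℕ → ℕ → ℕ → ℕ → ℕ → ℕ
t4 a1 a2 a3 a4 n =
  countIn (λ { (x , y , z , w) → a1 * tri x + a2 * tri y + a3 * tri z + a4 * tri w }) (suc n) n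

{-# OPTIONS --safe #-}
module Submission where

-- Put m = 4n + a + 3b and sort the representations (u, v, z, w) of m by a u² + a v² + b z² + 2b w²
-- according to the parity of u + v.
-- If u + v is odd, then u² + v² ≡ 1 (mod 4), so b z² + 2b w² ≡ 3b (mod 4), which forces z and w odd.
-- These are exactly the images φ(x, y, z', w') = (x + y - 1, x - y, 2z' - 1, 2w' - 1) of the solutions
-- of a x(x-1)/2 + a y(y-1)/2 + 2b z'(z'-1)/2 + 4b w'(w'-1)/2 = n, because
-- (x + y - 1)² + (x - y)² = 2x(x - 1) + 2y(y - 1) + 1 and (2k - 1)² = 4k(k - 1) + 1.
-- If u + v is even, then b z² is even, so z is even, and these are exactly the images
-- ψ(p, q, r, s) = (p + q, p - q, 2s, r) of the representations of m/2, since ψ doubles the form.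
-- Both maps are injective, hence N(m) = t(n) + N(m/2).

open import Defs
open import Data.Nat as ℕ using (ℕ; zero; suc; _≤_; _<_; z≤n; s≤s; z<s; _≟_; >-nonZero)
import Data.Nat.Properties as ℕ
open import Data.Nat.DivMod using (m*n/n≡m)
open import Data.Integer as ℤ using (ℤ; +_; -[1+_]; ∣_∣)
import Data.Integer.Properties as ℤ
open import Data.Integer.DivMod using (_%ℕ_; _/ℕ_; n%ℕd<d; a≡a%ℕn+[a/ℕn]*n)
open import Data.List using (List; []; _∷_; _++_; [_]; length; filter; map; concatMap; cartesianProduct; downFrom)
import Data.List.Properties as List
open import Data.List.Membership.Propositional using (_∈_; _∉_)
open import Data.List.Membership.Propositional.Properties
  using (∈-map⁺; ∈-map⁻; ∈-filter⁺; ∈-filter⁻; ∈-cartesianProduct⁺; ∈-cartesianProduct⁻)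
open import Data.List.Membership.Propositional.Properties.WithK using (unique∧set⇒bag)
open import Data.List.Relation.Binary.BagAndSetEquality using (∼bag⇒↭)
open import Data.List.Relation.Binary.Permutation.Propositional.Properties using (↭-length)
open import Data.List.Relation.Unary.Any using (here; there)
open import Data.List.Relation.Unary.All.Properties using (¬Any⇒All¬)
open import Data.List.Relation.Unary.AllPairs using ([]; _∷_)
open import Data.List.Relation.Unary.Unique.Propositional using (Unique)
import Data.List.Relation.Unary.Unique.Propositional.Properties as Unique
open import Data.Product using (∃-syntax; _×_; _,_; proj₁; proj₂; map₂)
open import Data.Product.Properties using (,-injective)
open import Data.Sum using (_⊎_; inj₁; inj₂)
open import Data.Empty using (⊥-elim)
open import Function using (_∘_; mk⇔)
open import Function.Definitions using (Injective)
open import Relation.Nullary using (¬_; yes; no)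
open import Relation.Unary using (Pred; Decidable; _∩_; _⟨×⟩_)
open import Relation.Unary.Properties using (∁?)
open import Relation.Binary.PropositionalEquality using (_≡_; _≢_; refl; sym; trans; cong; cong₂; subst; module ≡-Reasoning)
open ≡-Reasoning

ℤ⁴ : Set
ℤ⁴ = ℤ × ℤ × ℤ × ℤ

private variable
  A B C : Set
  P R S : Pred A _
  xs ys : List A

record Enumerates {A : Set} (P : Pred A _) (xs : List A) : Set where
  field
    unique   : Unique xs
    sound    : ∀ {x} → x ∈ xs → P x
    complete : ∀ {x} → P x → x ∈ xs

open Enumerates

enumerates-length : Enumerates P xs → Enumerates R ys →
                    (∀ {x} → P x → R x) → (∀ {x} → R x → P x) → length xs ≡ length ys
enumerates-length E F P⇒R R⇒P = ↭-length (∼bag⇒↭ (unique∧set⇒bag (unique E) (unique F)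
  (mk⇔ (complete F ∘ P⇒R ∘ sound E) (complete E ∘ R⇒P ∘ sound F))))

enumerates-filter : (S? : Decidable S) → Enumerates P xs → Enumerates (P ∩ S) (filter S? xs)
enumerates-filter S? E .unique = Unique.filter⁺ S? (unique E)
enumerates-filter S? E .sound x∈ with x∈xs , Sx ← ∈-filter⁻ S? x∈ = sound E x∈xs , Sx
enumerates-filter S? E .complete (Px , Sx) = ∈-filter⁺ S? (complete E Px) Sx

enumerates-map : {f : A → B} → Injective _≡_ _≡_ f → Enumerates P xs →
                 Enumerates (λ y → ∃[ x ] P x × f x ≡ y) (map f xs)
enumerates-map f-inj E .unique = Unique.map⁺ f-inj (unique E)
enumerates-map _ E .sound y∈ with x , x∈xs , refl ← ∈-map⁻ _ y∈ = x , sound E x∈xs , refl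
enumerates-map _ E .complete (x , Px , refl) = ∈-map⁺ _ (complete E Px)

enumerates-cartesianProduct : Enumerates P xs → Enumerates R ys →
                              Enumerates (P ⟨×⟩ R) (cartesianProduct xs ys)
enumerates-cartesianProduct E F .unique = Unique.cartesianProduct⁺ (unique E) (unique F)
enumerates-cartesianProduct E F .sound xy∈
  with x∈ , y∈ ← ∈-cartesianProduct⁻ _ _ xy∈ = sound E x∈ , sound F y∈
enumerates-cartesianProduct E F .complete (Px , Ry) =
  ∈-cartesianProduct⁺ (complete E Px) (complete F Ry)

length-filter-∁ : (P? : Decidable P) (xs : List A) →
                  length xs ≡ length (filter P? xs) ℕ.+ length (filter (∁? P?) xs)
length-filter-∁ P? []       = refl
length-filter-∁ P? (x ∷ xs) with P? x
... | yes _ = cong suc (length-filter-∁ P? xs)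
... | no  _ = trans (cong suc (length-filter-∁ P? xs)) (sym (ℕ.+-suc _ _))

concatMap-cartesianProduct : (f : A × B → List C) (xs : List A) (ys : List B) →
  concatMap f (cartesianProduct xs ys) ≡ concatMap (λ x → concatMap (λ y → f (x , y)) ys) xs
concatMap-cartesianProduct f []       ys = refl
concatMap-cartesianProduct f (x ∷ xs) ys = begin
  concatMap f (map (x ,_) ys ++ cartesianProduct xs ys)
    ≡⟨ List.concatMap-++ f (map (x ,_) ys) (cartesianProduct xs ys) ⟩
  concatMap f (map (x ,_) ys) ++ concatMap f (cartesianProduct xs ys)
    ≡⟨ cong₂ _++_ (List.concatMap-map f (x ,_) ys) (concatMap-cartesianProduct f xs ys) ⟩
  concatMap (λ y → f (x , y)) ys ++ concatMap (λ x → concatMap (λ y → f (x , y)) ys) xs ∎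

punctured : ℕ → List ℤ
punctured B = concatMap (λ k → + suc k ∷ -[1+ k ] ∷ []) (downFrom B)

punctured-sound : ∀ B {x} → x ∈ punctured B → 0 < ∣ x ∣ × ∣ x ∣ ≤ B
punctured-sound (suc B) (here refl)         = z<s , ℕ.≤-refl
punctured-sound (suc B) (there (here refl)) = z<s , ℕ.≤-refl
punctured-sound (suc B) (there (there x∈))  = map₂ ℕ.m≤n⇒m≤1+n (punctured-sound B x∈)

punctured-complete : ∀ B {x} → 0 < ∣ x ∣ → ∣ x ∣ ≤ B → x ∈ punctured B
punctured-complete zero    0<∣x∣ ∣x∣≤0 = ⊥-elim (ℕ.<⇒≱ 0<∣x∣ ∣x∣≤0)
punctured-complete (suc B) {x} 0<∣x∣ ∣x∣≤1+B with ℕ.m≤n⇒m<n∨m≡n ∣x∣≤1+B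
punctured-complete (suc B) {x}         0<∣x∣ _ | inj₁ ∣x∣<1+B =
  there (there (punctured-complete B 0<∣x∣ (ℕ.≤-pred ∣x∣<1+B)))
punctured-complete (suc B) {+ _}       _ _ | inj₂ refl = here refl
punctured-complete (suc B) { -[1+ _ ]} _ _ | inj₂ refl = there (here refl)

punctured-unique : ∀ B → Unique (punctured B)
punctured-unique zero    = []
punctured-unique (suc B) = ¬Any⇒All¬ _ +1+B∉ ∷ ¬Any⇒All¬ _ (outside refl) ∷ punctured-unique B
  where
  outside : ∀ {x} → ∣ x ∣ ≡ suc B → x ∉ punctured B
  outside ∣x∣≡1+B x∈ = ℕ.1+n≰n (subst (_≤ B) ∣x∣≡1+B (proj₂ (punctured-sound B x∈)))
  +1+B∉ : + suc B ∉ -[1+ B ] ∷ punctured B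
  +1+B∉ (there x∈) = outside refl x∈

box-enumerates : ∀ B → Enumerates (λ x → ∣ x ∣ ≤ B) (box B)
box-enumerates B .unique =
  ¬Any⇒All¬ _ (λ 0∈ → ℕ.n≮n 0 (proj₁ (punctured-sound B 0∈))) ∷ punctured-unique B
box-enumerates B .sound (here refl) = z≤n
box-enumerates B .sound (there x∈)  = proj₂ (punctured-sound B x∈)
box-enumerates B .complete {+ zero}     _     = here refl
box-enumerates B .complete {+ suc _}    ∣x∣≤B = there (punctured-complete B z<s ∣x∣≤B)
box-enumerates B .complete { -[1+ _ ]} ∣x∣≤B = there (punctured-complete B z<s ∣x∣≤B)

Bounded : ℕ → Pred ℤ⁴ _
Bounded B (x , y , z , w) = ∣ x ∣ ≤ B × ∣ y ∣ ≤ B × ∣ z ∣ ≤ B × ∣ w ∣ ≤ B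

box4-cartesianProduct : ∀ B →
  box4 B ≡ cartesianProduct (box B) (cartesianProduct (box B) (cartesianProduct (box B) (box B)))
box4-cartesianProduct B = sym (begin
  cartesianProduct L (cartesianProduct L (cartesianProduct L L))
    ≡⟨ List.concatMap-pure _ ⟨
  concatMap [_] (cartesianProduct L (cartesianProduct L (cartesianProduct L L)))
    ≡⟨ concatMap-cartesianProduct [_] L (cartesianProduct L (cartesianProduct L L)) ⟩
  concatMap (λ x → concatMap (λ yzw → [ x , yzw ]) (cartesianProduct L (cartesianProduct L L))) L
    ≡⟨ List.concatMap-cong (λ x →
         concatMap-cartesianProduct (λ yzw → [ x , yzw ]) L (cartesianProduct L L)) L ⟩
  concatMap (λ x → concatMap (λ y → concatMap (λ zw → [ x , y , zw ]) (cartesianProduct L L)) L) L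
    ≡⟨ List.concatMap-cong (λ x → List.concatMap-cong (λ y →
         concatMap-cartesianProduct (λ zw → [ x , y , zw ]) L L) L) L ⟩
  box4 B ∎)
  where L = box B

box4-enumerates : ∀ B → Enumerates (Bounded B) (box4 B)
box4-enumerates B = subst (Enumerates (Bounded B)) (sym (box4-cartesianProduct B))
  (enumerates-cartesianProduct I (enumerates-cartesianProduct I (enumerates-cartesianProduct I I)))
  where I = box-enumerates B

solutions : (ℤ⁴ → ℕ) → ℕ → ℕ → List ℤ⁴
solutions f B n = filter (λ v → f v ≟ n) (box4 B)

solutions-enumerates : ∀ {f B n} → (∀ {v} → f v ≡ n → Bounded B v) →
                       Enumerates (λ v → f v ≡ n) (solutions f B n)
solutions-enumerates {f} {B} {n} bounded = record
  { unique   = unique E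
  ; sound    = proj₂ ∘ sound E
  ; complete = λ fv≡n → complete E (bounded fv≡n , fv≡n)
  }
  where E = enumerates-filter (λ v → f v ≟ n) (box4-enumerates B)

module _ where
  open import Data.Nat using (_+_; _*_; _/_)

  triangle : ℕ → ℕ
  triangle zero    = 0
  triangle (suc k) = suc k + triangle k

  triangle-double : ∀ k → triangle k * 2 ≡ k * suc k
  triangle-double zero    = refl
  triangle-double (suc k) = begin
    (suc k + triangle k) * 2      ≡⟨ ℕ.*-distribʳ-+ 2 (suc k) (triangle k) ⟩
    suc k * 2 + triangle k * 2    ≡⟨ cong (λ t → suc k * 2 + t) (triangle-double k) ⟩
    suc k * 2 + k * suc k         ≡⟨ cong (_+ k * suc k) (ℕ.*-comm (suc k) 2) ⟩
    2 * suc k + k * suc k         ≡⟨ ℕ.*-distribʳ-+ (suc k) 2 k ⟨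
    suc (suc k) * suc k           ≡⟨ ℕ.*-comm (suc (suc k)) (suc k) ⟩
    suc k * suc (suc k)           ∎

  tri-+suc : ∀ k → tri (+ suc k) ≡ triangle k
  tri-+suc k = begin
    ∣ + suc k ℤ.* + k ∣ / 2   ≡⟨ cong (_/ 2) (ℤ.abs-* (+ suc k) (+ k)) ⟩
    suc k * k / 2             ≡⟨ cong (_/ 2) (trans (ℕ.*-comm (suc k) k) (sym (triangle-double k))) ⟩
    triangle k * 2 / 2        ≡⟨ m*n/n≡m (triangle k) 2 ⟩
    triangle k                ∎

  tri-neg : ∀ k → tri -[1+ k ] ≡ triangle (suc k)
  tri-neg k = begin
    ∣ -[1+ k ] ℤ.* (-[1+ k ] ℤ.- + 1) ∣ / 2 ≡⟨ cong (_/ 2) (ℤ.abs-* -[1+ k ] (-[1+ k ] ℤ.- + 1)) ⟩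
    suc k * suc (suc (k + 0)) / 2         ≡⟨ cong (λ t → suc k * suc (suc t) / 2) (ℕ.+-identityʳ k) ⟩
    suc k * suc (suc k) / 2               ≡⟨ cong (_/ 2) (sym (triangle-double (suc k))) ⟩
    triangle (suc k) * 2 / 2              ≡⟨ m*n/n≡m (triangle (suc k)) 2 ⟩
    triangle (suc k)                      ∎

  ∣i∣≤sq : ∀ x → ∣ x ∣ ≤ sq x
  ∣i∣≤sq (+ zero)  = z≤n
  ∣i∣≤sq (+ suc k) = ℕ.m≤m*n (suc k) (suc k)
  ∣i∣≤sq -[1+ k ]  = ℕ.m≤m*n (suc k) (suc k)

  n≤triangle : ∀ n → n ≤ triangle n
  n≤triangle zero    = z≤n
  n≤triangle (suc n) = ℕ.m≤m+n (suc n) (triangle n)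

  ∣i∣≤1+tri : ∀ x → ∣ x ∣ ≤ suc (tri x)
  ∣i∣≤1+tri (+ zero)  = z≤n
  ∣i∣≤1+tri (+ suc k) = subst (λ t → suc k ≤ suc t) (sym (tri-+suc k)) (s≤s (n≤triangle k))
  ∣i∣≤1+tri -[1+ k ]  =
    subst (λ t → suc k ≤ suc t) (sym (tri-neg k)) (ℕ.m≤n⇒m≤1+n (n≤triangle (suc k)))

  sqForm triForm : ℕ → ℕ → ℕ → ℕ → ℤ⁴ → ℕ
  sqForm  a₁ a₂ a₃ a₄ (x , y , z , w) = a₁ * sq x  + a₂ * sq y  + a₃ * sq z  + a₄ * sq w
  triForm a₁ a₂ a₃ a₄ (x , y , z , w) = a₁ * tri x + a₂ * tri y + a₃ * tri z + a₄ * tri w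

  summands≤weightedSum : ∀ {a₁ a₂ a₃ a₄} → 0 < a₁ → 0 < a₂ → 0 < a₃ → 0 < a₄ → ∀ s₁ s₂ s₃ s₄ →
    let S = a₁ * s₁ + a₂ * s₂ + a₃ * s₃ + a₄ * s₄ in s₁ ≤ S × s₂ ≤ S × s₃ ≤ S × s₄ ≤ S
  summands≤weightedSum {a₁} {a₂} {a₃} {a₄} 0<a₁ 0<a₂ 0<a₃ 0<a₄ s₁ s₂ s₃ s₄ =
    ℕ.≤-trans (s≤a*s 0<a₁) (ℕ.≤-trans (ℕ.m≤m+n (a₁ * s₁) (a₂ * s₂))
      (ℕ.≤-trans (ℕ.m≤m+n _ (a₃ * s₃)) (ℕ.m≤m+n _ (a₄ * s₄)))) ,
    ℕ.≤-trans (s≤a*s 0<a₂) (ℕ.≤-trans (ℕ.m≤n+m (a₂ * s₂) (a₁ * s₁))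
      (ℕ.≤-trans (ℕ.m≤m+n _ (a₃ * s₃)) (ℕ.m≤m+n _ (a₄ * s₄)))) ,
    ℕ.≤-trans (s≤a*s 0<a₃) (ℕ.≤-trans (ℕ.m≤n+m (a₃ * s₃) (a₁ * s₁ + a₂ * s₂))
      (ℕ.m≤m+n _ (a₄ * s₄))) ,
    ℕ.≤-trans (s≤a*s 0<a₄) (ℕ.m≤n+m (a₄ * s₄) _)
    where
    s≤a*s : ∀ {a s} → 0 < a → s ≤ a * s
    s≤a*s {a} {s} 0<a = ℕ.m≤n*m s a {{>-nonZero 0<a}}

  sqForm-bounded : ∀ {a₁ a₂ a₃ a₄} → 0 < a₁ → 0 < a₂ → 0 < a₃ → 0 < a₄ →
                   ∀ v → Bounded (sqForm a₁ a₂ a₃ a₄ v) v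
  sqForm-bounded 0<a₁ 0<a₂ 0<a₃ 0<a₄ (x , y , z , w)
    with s₁≤ , s₂≤ , s₃≤ , s₄≤ ←
           summands≤weightedSum 0<a₁ 0<a₂ 0<a₃ 0<a₄ (sq x) (sq y) (sq z) (sq w) =
    ℕ.≤-trans (∣i∣≤sq x) s₁≤ , ℕ.≤-trans (∣i∣≤sq y) s₂≤ ,
    ℕ.≤-trans (∣i∣≤sq z) s₃≤ , ℕ.≤-trans (∣i∣≤sq w) s₄≤

  triForm-bounded : ∀ {a₁ a₂ a₃ a₄} → 0 < a₁ → 0 < a₂ → 0 < a₃ → 0 < a₄ →
                    ∀ v → Bounded (suc (triForm a₁ a₂ a₃ a₄ v)) v
  triForm-bounded 0<a₁ 0<a₂ 0<a₃ 0<a₄ (x , y , z , w)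
    with s₁≤ , s₂≤ , s₃≤ , s₄≤ ←
           summands≤weightedSum 0<a₁ 0<a₂ 0<a₃ 0<a₄ (tri x) (tri y) (tri z) (tri w) =
    ℕ.≤-trans (∣i∣≤1+tri x) (s≤s s₁≤) , ℕ.≤-trans (∣i∣≤1+tri y) (s≤s s₂≤) ,
    ℕ.≤-trans (∣i∣≤1+tri z) (s≤s s₃≤) , ℕ.≤-trans (∣i∣≤1+tri w) (s≤s s₄≤)

  Q T : ℕ → ℕ → ℤ⁴ → ℕ
  Q a b = sqForm a a b (2 * b)
  T a b = triForm a a (2 * b) (4 * b)

module _ where
  open import Data.Integer using (_+_; _*_; _-_)
  open import Data.Integer.Tactic.RingSolver using (solve-∀; solve)

  Evenℤ Oddℤ : ℤ → Set
  Evenℤ x = ∃[ k ] x ≡ + 2 * k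
  Oddℤ  x = ∃[ k ] x ≡ + 2 * k + + 1

  parity : ∀ x → Evenℤ x ⊎ Oddℤ x
  parity x with x %ℕ 2 | n%ℕd<d x 2 | a≡a%ℕn+[a/ℕn]*n x 2
  ... | 0           | _            | x≡ =
    inj₁ (x /ℕ 2 , trans x≡ (trans (ℤ.+-identityˡ _) (ℤ.*-comm (x /ℕ 2) (+ 2))))
  ... | 1           | _            | x≡ =
    inj₂ (x /ℕ 2 , trans x≡ (trans (ℤ.+-comm (+ 1) (x /ℕ 2 * + 2))
                                   (cong (_+ + 1) (ℤ.*-comm (x /ℕ 2) (+ 2)))))
  ... | suc (suc _) | s≤s (s≤s ()) | _

  1≢2*m : ∀ m → 1 ≢ 2 ℕ.* m
  1≢2*m zero    ()
  1≢2*m (suc m) 1≡ = ℕ.m+1+n≢0 m (sym (ℕ.suc-injective 1≡))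

  even⇒¬odd : ∀ {x} → Evenℤ x → ¬ Oddℤ x
  even⇒¬odd (l , refl) (k , 2l≡2k+1) = 1≢2*m ∣ l - k ∣ (begin
    ∣ + 1 ∣                   ≡⟨ cong ∣_∣ (begin
      + 1                     ≡⟨ solve (k ∷ []) ⟩
      + 2 * k + + 1 - + 2 * k ≡⟨ cong (_- + 2 * k) 2l≡2k+1 ⟨
      + 2 * l - + 2 * k       ≡⟨ solve (l ∷ k ∷ []) ⟩
      + 2 * (l - k)           ∎) ⟩
    ∣ + 2 * (l - k) ∣         ≡⟨ ℤ.abs-* (+ 2) (l - k) ⟩
    2 ℕ.* ∣ l - k ∣           ∎)

  ¬odd⇒even : ∀ {x} → ¬ Oddℤ x → Evenℤ x
  ¬odd⇒even {x} ¬x-odd with parity x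
  ... | inj₁ x-even = x-even
  ... | inj₂ x-odd  = ⊥-elim (¬x-odd x-odd)

  odd-+-even : ∀ {x} k → Oddℤ x → Oddℤ (+ 2 * k + x)
  odd-+-even k (l , refl) = k + l , solve (k ∷ l ∷ [])

  *-odd : ∀ {x y} → Oddℤ x → Oddℤ y → Oddℤ (x * y)
  *-odd (k , refl) (l , refl) = + 2 * k * l + k + l , solve (k ∷ l ∷ [])

  odd-factorʳ : ∀ x {y} → Oddℤ (x * y) → Oddℤ y
  odd-factorʳ x {y} xy-odd with parity y
  ... | inj₂ y-odd      = y-odd
  ... | inj₁ (l , refl) = ⊥-elim (even⇒¬odd {x * (+ 2 * l)} (x * l , solve (x ∷ l ∷ [])) xy-odd)

  even-factorʳ : ∀ {x y} → Oddℤ x → Evenℤ (x * y) → Evenℤ y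
  even-factorʳ {y = y} x-odd xy-even with parity y
  ... | inj₁ y-even = y-even
  ... | inj₂ y-odd  = ⊥-elim (even⇒¬odd xy-even (*-odd x-odd y-odd))

  even-square⇒even : ∀ {x} → Evenℤ (x * x) → Evenℤ x
  even-square⇒even {x} xx-even with parity x
  ... | inj₁ x-even = x-even
  ... | inj₂ x-odd  = ⊥-elim (even⇒¬odd xx-even (*-odd x-odd x-odd))

  odd-square : ∀ {x} → Oddℤ x → ∃[ t ] x * x ≡ + 4 * t + + 1
  odd-square (k , refl) = k * k + k , solve (k ∷ [])

  isolateʳ : ∀ {x y s} → x + y ≡ s → y ≡ s - x
  isolateʳ {x} {y} {s} x+y≡s = begin
    y         ≡⟨ solve (x ∷ y ∷ []) ⟩
    x + y - x ≡⟨ cong (_- x) x+y≡s ⟩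
    s - x     ∎

  sum-of-squares-odd : ∀ {u v} → Oddℤ (u + v) → ∃[ q ] u * u + v * v ≡ + 4 * q + + 1
  sum-of-squares-odd {u} {v} (k , u+v≡) with refl ← isolateʳ {u} {v} u+v≡ | parity u
  ... | inj₁ (p , refl) = p * p + (k - p) * (k - p) + (k - p) , (begin
    + 2 * p * (+ 2 * p) + (+ 2 * k + + 1 - + 2 * p) * (+ 2 * k + + 1 - + 2 * p)
      ≡⟨ solve (k ∷ p ∷ []) ⟩
    + 4 * (p * p + (k - p) * (k - p) + (k - p)) + + 1 ∎)
  ... | inj₂ (p , refl) = p * p + p + (k - p) * (k - p) , (begin
    (+ 2 * p + + 1) * (+ 2 * p + + 1) + (+ 2 * k + + 1 - (+ 2 * p + + 1)) * (+ 2 * k + + 1 - (+ 2 * p + + 1))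
      ≡⟨ solve (k ∷ p ∷ []) ⟩
    + 4 * (p * p + p + (k - p) * (k - p)) + + 1 ∎)

  sum-of-squares-even : ∀ {u v} → Evenℤ (u + v) → Evenℤ (u * u + v * v)
  sum-of-squares-even {u} {v} (k , u+v≡) with refl ← isolateʳ {u} {v} u+v≡ =
    (u - k) * (u - k) + k * k , (begin
      u * u + (+ 2 * k - u) * (+ 2 * k - u) ≡⟨ solve (u ∷ k ∷ []) ⟩
      + 2 * ((u - k) * (u - k) + k * k)     ∎)

  pos-sq : ∀ x → + sq x ≡ x * x
  pos-sq (+ k)    = trans (cong +_ (ℤ.abs-* (+ k) (+ k))) (ℤ.pos-* k k)
  pos-sq -[1+ k ] = refl

  double-tri : ∀ x → + 2 * + tri x ≡ x * x - x
  double-tri (+ zero)  = refl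
  double-tri (+ suc k) = begin
    + 2 * + tri (+ suc k)   ≡⟨ cong (λ t → + 2 * + t) (tri-+suc k) ⟩
    + 2 * + triangle k      ≡⟨ ℤ.pos-* 2 (triangle k) ⟨
    + (2 ℕ.* triangle k)    ≡⟨ cong +_ (trans (ℕ.*-comm 2 (triangle k)) (triangle-double k)) ⟩
    + (k ℕ.* suc k)         ≡⟨ ℤ.pos-* k (suc k) ⟩
    + k * (+ 1 + + k)       ≡⟨ identity (+ k) ⟩
    (+ 1 + + k) * (+ 1 + + k) - (+ 1 + + k) ∎
    where
    identity : ∀ K → K * (+ 1 + K) ≡ (+ 1 + K) * (+ 1 + K) - (+ 1 + K)
    identity = solve-∀
  double-tri -[1+ k ]  = begin
    + 2 * + tri -[1+ k ]        ≡⟨ cong (λ t → + 2 * + t) (tri-neg k) ⟩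
    + 2 * + triangle (suc k)    ≡⟨ ℤ.pos-* 2 (triangle (suc k)) ⟨
    + (2 ℕ.* triangle (suc k))  ≡⟨ cong +_ (trans (ℕ.*-comm 2 (triangle (suc k))) (triangle-double (suc k))) ⟩
    + (suc k ℕ.* suc (suc k))   ≡⟨ ℤ.pos-* (suc k) (suc (suc k)) ⟩
    (+ 1 + + k) * (+ 2 + + k)   ≡⟨ identity (+ k) ⟩
    ℤ.- (+ 1 + + k) * ℤ.- (+ 1 + + k) - ℤ.- (+ 1 + + k) ∎
    where
    identity : ∀ K → (+ 1 + K) * (+ 2 + K) ≡ ℤ.- (+ 1 + K) * ℤ.- (+ 1 + K) - ℤ.- (+ 1 + K)
    identity = solve-∀

  Qℤ twiceTℤ : ℤ → ℤ → ℤ⁴ → ℤ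
  Qℤ      A B (x , y , z , w) = A * (x * x) + A * (y * y) + B * (z * z) + + 2 * B * (w * w)
  twiceTℤ A B (x , y , z , w) =
    A * (x * x - x) + A * (y * y - y) + + 2 * B * (z * z - z) + + 4 * B * (w * w - w)

  pos-Q : ∀ a b v → + Q a b v ≡ Qℤ (+ a) (+ b) v
  pos-Q a b (x , y , z , w) = begin
    + (a ℕ.* sq x) + + (a ℕ.* sq y) + + (b ℕ.* sq z) + + (2 ℕ.* b ℕ.* sq w)
      ≡⟨ cong₂ _+_ (cong₂ _+_ (cong₂ _+_ (term a x) (term a y)) (term b z)) (term (2 ℕ.* b) w) ⟩
    + a * (x * x) + + a * (y * y) + + b * (z * z) + + (2 ℕ.* b) * (w * w)
      ≡⟨ cong (λ c → + a * (x * x) + + a * (y * y) + + b * (z * z) + c * (w * w)) (ℤ.pos-* 2 b) ⟩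
    Qℤ (+ a) (+ b) (x , y , z , w) ∎
    where
    term : ∀ c x → + (c ℕ.* sq x) ≡ + c * (x * x)
    term c x = trans (ℤ.pos-* c (sq x)) (cong (+ c *_) (pos-sq x))

  twiceTℤ≡2T : ∀ a b v → twiceTℤ (+ a) (+ b) v ≡ + 2 * + T a b v
  twiceTℤ≡2T a b (x , y , z , w) = begin
    W (x * x - x) (y * y - y) (z * z - z) (w * w - w)
      ≡⟨ cong₂ (λ p q → W p q (z * z - z) (w * w - w)) (double-tri x) (double-tri y) ⟨
    W (+ 2 * tx) (+ 2 * ty) (z * z - z) (w * w - w)
      ≡⟨ cong₂ (W (+ 2 * tx) (+ 2 * ty)) (double-tri z) (double-tri w) ⟨
    W (+ 2 * tx) (+ 2 * ty) (+ 2 * tz) (+ 2 * tw)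
      ≡⟨ factor (+ a) (+ b) tx ty tz tw ⟩
    + 2 * (+ a * tx + + a * ty + + 2 * + b * tz + + 4 * + b * tw)
      ≡⟨ cong (+ 2 *_) pos-T ⟨
    + 2 * + T a b (x , y , z , w) ∎
    where
    tx = + tri x
    ty = + tri y
    tz = + tri z
    tw = + tri w
    W : ℤ → ℤ → ℤ → ℤ → ℤ
    W p q r s = + a * p + + a * q + + 2 * + b * r + + 4 * + b * s
    pos-*³ : ∀ c d t → + (c ℕ.* d ℕ.* t) ≡ + c * + d * + t
    pos-*³ c d t = trans (ℤ.pos-* (c ℕ.* d) t) (cong (_* + t) (ℤ.pos-* c d))
    pos-T : + T a b (x , y , z , w) ≡ W tx ty tz tw
    pos-T = begin
      + (a ℕ.* tri x) + + (a ℕ.* tri y) + + (2 ℕ.* b ℕ.* tri z) + + (4 ℕ.* b ℕ.* tri w)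
        ≡⟨ cong₂ _+_ (cong₂ _+_ (cong₂ _+_ (ℤ.pos-* a (tri x)) (ℤ.pos-* a (tri y)))
                                (pos-*³ 2 b (tri z))) (pos-*³ 4 b (tri w)) ⟩
      W tx ty tz tw ∎
    factor : ∀ A B p q r s →
      A * (+ 2 * p) + A * (+ 2 * q) + + 2 * B * (+ 2 * r) + + 4 * B * (+ 2 * s)
        ≡ + 2 * (A * p + A * q + + 2 * B * r + + 4 * B * s)
    factor = solve-∀

  mod4-forces-odd : ∀ {B z w M} → Oddℤ B → B * (z * z) + + 2 * B * (w * w) ≡ + 4 * M + + 3 * B →
                    Oddℤ z × Oddℤ w
  mod4-forces-odd {B} {z} {w} {M} B-odd eq = z-odd , w-odd
    where
    Bzz≡ : B * (z * z) ≡ + 2 * (+ 2 * M + B - B * (w * w)) + B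
    Bzz≡ = begin
      B * (z * z)                                         ≡⟨ solve (B ∷ z ∷ w ∷ []) ⟩
      B * (z * z) + + 2 * B * (w * w) - + 2 * B * (w * w) ≡⟨ cong (_- + 2 * B * (w * w)) eq ⟩
      + 4 * M + + 3 * B - + 2 * B * (w * w)               ≡⟨ solve (B ∷ w ∷ M ∷ []) ⟩
      + 2 * (+ 2 * M + B - B * (w * w)) + B               ∎

    z-odd : Oddℤ z
    z-odd = odd-factorʳ z (odd-factorʳ B
      (subst Oddℤ (sym Bzz≡) (odd-+-even (+ 2 * M + B - B * (w * w)) B-odd)))

    w-odd : Oddℤ w
    w-odd with t , zz≡ ← odd-square z-odd =
      odd-factorʳ w (odd-factorʳ B (subst Oddℤ (sym Bww≡) (odd-+-even (M - B * t) B-odd)))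
      where
      Bww≡ : B * (w * w) ≡ + 2 * (M - B * t) + B
      Bww≡ = ℤ.*-cancelˡ-≡ (+ 2) _ _ (begin
        + 2 * (B * (w * w))                           ≡⟨ solve (B ∷ z ∷ w ∷ []) ⟩
        B * (z * z) + + 2 * B * (w * w) - B * (z * z) ≡⟨ cong₂ (λ L zz → L - B * zz) eq zz≡ ⟩
        + 4 * M + + 3 * B - B * (+ 4 * t + + 1)       ≡⟨ solve (B ∷ M ∷ t ∷ []) ⟩
        + 2 * (+ 2 * (M - B * t) + B)                 ∎)

  mod2-forces-even : ∀ {B z w M} → Oddℤ B → B * (z * z) + + 2 * B * (w * w) ≡ + 2 * M → Evenℤ z
  mod2-forces-even {B} {z} {w} {M} B-odd eq =
    even-square⇒even (even-factorʳ B-odd (M - B * (w * w) , (begin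
      B * (z * z)                                         ≡⟨ solve (B ∷ z ∷ w ∷ []) ⟩
      B * (z * z) + + 2 * B * (w * w) - + 2 * B * (w * w) ≡⟨ cong (_- + 2 * B * (w * w)) eq ⟩
      + 2 * M - + 2 * B * (w * w)                         ≡⟨ solve (B ∷ w ∷ M ∷ []) ⟩
      + 2 * (M - B * (w * w))                             ∎)))

  oddSum-forces-odd : ∀ A B N u v z w → Oddℤ B → Qℤ A B (u , v , z , w) ≡ + 4 * N + A + + 3 * B →
                      Oddℤ (u + v) → Oddℤ z × Oddℤ w
  oddSum-forces-odd A B N u v z w B-odd Q≡ u+v-odd
    with q , S≡ ← sum-of-squares-odd {u} {v} u+v-odd =
    mod4-forces-odd {B} {z} {w} {N - A * q} B-odd (begin
      B * (z * z) + + 2 * B * (w * w)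
        ≡⟨ solve (A ∷ B ∷ u ∷ v ∷ z ∷ w ∷ []) ⟩
      A * (u * u) + A * (v * v) + B * (z * z) + + 2 * B * (w * w) - A * (u * u + v * v)
        ≡⟨ cong₂ (λ L S → L - A * S) Q≡ S≡ ⟩
      + 4 * N + A + + 3 * B - A * (+ 4 * q + + 1)
        ≡⟨ solve (A ∷ B ∷ N ∷ q ∷ []) ⟩
      + 4 * (N - A * q) + + 3 * B ∎)

  evenSum-forces-even : ∀ A B M u v z w → Oddℤ B → Qℤ A B (u , v , z , w) ≡ + 2 * M →
                        Evenℤ (u + v) → Evenℤ z
  evenSum-forces-even A B M u v z w B-odd Q≡ u+v-even
    with s , S≡ ← sum-of-squares-even {u} {v} u+v-even =
    mod2-forces-even {B} {z} {w} {M - A * s} B-odd (begin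
      B * (z * z) + + 2 * B * (w * w)
        ≡⟨ solve (A ∷ B ∷ u ∷ v ∷ z ∷ w ∷ []) ⟩
      A * (u * u) + A * (v * v) + B * (z * z) + + 2 * B * (w * w) - A * (u * u + v * v)
        ≡⟨ cong₂ (λ L S → L - A * S) Q≡ S≡ ⟩
      + 2 * M - A * (+ 2 * s)
        ≡⟨ solve (A ∷ M ∷ s ∷ []) ⟩
      + 2 * (M - A * s) ∎)

  φ ψ : ℤ⁴ → ℤ⁴
  φ (x , y , z , w) = (x + y - + 1 , x - y , + 2 * z - + 1 , + 2 * w - + 1)
  ψ (p , q , r , s) = (p + q , p - q , + 2 * s , r)

  Qℤ-φ : ∀ A B v → Qℤ A B (φ v) ≡ + 2 * twiceTℤ A B v + A + + 3 * B
  Qℤ-φ A B (x , y , z , w) = begin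
    A * ((x + y - + 1) * (x + y - + 1)) + A * ((x - y) * (x - y))
      + B * ((+ 2 * z - + 1) * (+ 2 * z - + 1)) + + 2 * B * ((+ 2 * w - + 1) * (+ 2 * w - + 1))
      ≡⟨ solve (A ∷ B ∷ x ∷ y ∷ z ∷ w ∷ []) ⟩
    + 2 * (A * (x * x - x) + A * (y * y - y) + + 2 * B * (z * z - z) + + 4 * B * (w * w - w))
      + A + + 3 * B ∎

  Qℤ-ψ : ∀ A B v → Qℤ A B (ψ v) ≡ + 2 * Qℤ A B v
  Qℤ-ψ A B (p , q , r , s) = begin
    A * ((p + q) * (p + q)) + A * ((p - q) * (p - q)) + B * (+ 2 * s * (+ 2 * s)) + + 2 * B * (r * r)
      ≡⟨ solve (A ∷ B ∷ p ∷ q ∷ r ∷ s ∷ []) ⟩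
    + 2 * (A * (p * p) + A * (q * q) + B * (r * r) + + 2 * B * (s * s)) ∎

  SumOdd : Pred ℤ⁴ _
  SumOdd (u , v , _ , _) = Oddℤ (u + v)

  SumOdd? : Decidable SumOdd
  SumOdd? (u , v , _ , _) with parity (u + v)
  ... | inj₁ u+v-even = no (even⇒¬odd u+v-even)
  ... | inj₂ u+v-odd  = yes u+v-odd

  φ-sumOdd : ∀ p → SumOdd (φ p)
  φ-sumOdd (x , y , _ , _) = x - + 1 , (begin
    x + y - + 1 + (x - y) ≡⟨ solve (x ∷ y ∷ []) ⟩
    + 2 * (x - + 1) + + 1 ∎)

  ψ-¬sumOdd : ∀ p → ¬ SumOdd (ψ p)
  ψ-¬sumOdd (p , q , _ , _) = even⇒¬odd (p , (begin
    p + q + (p - q) ≡⟨ solve (p ∷ q ∷ []) ⟩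
    + 2 * p         ∎))

  double : ℤ⁴ → ℤ⁴
  double (x , y , z , w) = (+ 2 * x , + 2 * y , + 2 * z , + 2 * w)

  double-injective : Injective _≡_ _≡_ double
  double-injective {_ , _ , _ , _} {_ , _ , _ , _} 2p≡2p′
    with e₁ , e₂₃₄ ← ,-injective 2p≡2p′
    with e₂ , e₃₄  ← ,-injective e₂₃₄
    with e₃ , e₄   ← ,-injective e₃₄ =
    cong₂ _,_ (halve e₁) (cong₂ _,_ (halve e₂) (cong₂ _,_ (halve e₃) (halve e₄)))
    where
    halve : ∀ {x y} → + 2 * x ≡ + 2 * y → x ≡ y
    halve = ℤ.*-cancelˡ-≡ (+ 2) _ _

  φ-injective : Injective _≡_ _≡_ φ
  φ-injective {p} {p′} φp≡φp′ = double-injective (begin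
    double p       ≡⟨ unφ-φ p ⟨
    unφ (φ p)      ≡⟨ cong unφ φp≡φp′ ⟩
    unφ (φ p′)     ≡⟨ unφ-φ p′ ⟩
    double p′      ∎)
    where
    unφ : ℤ⁴ → ℤ⁴
    unφ (u , v , z , w) = (u + v + + 1 , u - v + + 1 , z + + 1 , w + + 1)
    unφ-φ : ∀ p → unφ (φ p) ≡ double p
    unφ-φ (x , y , z , w) =
      cong₂ _,_ (begin x + y - + 1 + (x - y) + + 1 ≡⟨ solve (x ∷ y ∷ []) ⟩ + 2 * x ∎)
      (cong₂ _,_ (begin x + y - + 1 - (x - y) + + 1 ≡⟨ solve (x ∷ y ∷ []) ⟩ + 2 * y ∎)
      (cong₂ _,_ (begin + 2 * z - + 1 + + 1 ≡⟨ solve (z ∷ []) ⟩ + 2 * z ∎)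
                 (begin + 2 * w - + 1 + + 1 ≡⟨ solve (w ∷ []) ⟩ + 2 * w ∎)))

  ψ-injective : Injective _≡_ _≡_ ψ
  ψ-injective {p} {p′} ψp≡ψp′ = double-injective (begin
    double p       ≡⟨ unψ-ψ p ⟨
    unψ (ψ p)      ≡⟨ cong unψ ψp≡ψp′ ⟩
    unψ (ψ p′)     ≡⟨ unψ-ψ p′ ⟩
    double p′      ∎)
    where
    unψ : ℤ⁴ → ℤ⁴
    unψ (u , v , z , w) = (u + v , u - v , + 2 * w , z)
    unψ-ψ : ∀ p → unψ (ψ p) ≡ double p
    unψ-ψ (p , q , r , s) =
      cong₂ _,_ (begin p + q + (p - q) ≡⟨ solve (p ∷ q ∷ []) ⟩ + 2 * p ∎)
      (cong₂ _,_ (begin p + q - (p - q) ≡⟨ solve (p ∷ q ∷ []) ⟩ + 2 * q ∎) refl)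

  φ-preimage : ∀ {u v z w} → Oddℤ (u + v) → Oddℤ z → Oddℤ w → ∃[ p ] φ p ≡ (u , v , z , w)
  φ-preimage {u} {v} (k , u+v≡) (r , refl) (s , refl) with refl ← isolateʳ {u} {v} u+v≡ =
    (k + + 1 , u - k , r + + 1 , s + + 1) ,
    cong₂ _,_ (begin k + + 1 + (u - k) - + 1 ≡⟨ solve (k ∷ u ∷ []) ⟩ u ∎)
    (cong₂ _,_ (begin k + + 1 - (u - k) ≡⟨ solve (k ∷ u ∷ []) ⟩ + 2 * k + + 1 - u ∎)
    (cong₂ _,_ (begin + 2 * (r + + 1) - + 1 ≡⟨ solve (r ∷ []) ⟩ + 2 * r + + 1 ∎)
               (begin + 2 * (s + + 1) - + 1 ≡⟨ solve (s ∷ []) ⟩ + 2 * s + + 1 ∎)))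

  ψ-preimage : ∀ {u v z w} → Evenℤ (u + v) → Evenℤ z → ∃[ p ] ψ p ≡ (u , v , z , w)
  ψ-preimage {u} {v} {w = w} (k , u+v≡) (r , refl) with refl ← isolateʳ {u} {v} u+v≡ =
    (k , u - k , w , r) ,
    cong₂ _,_ (begin k + (u - k) ≡⟨ solve (k ∷ u ∷ []) ⟩ u ∎)
    (cong₂ _,_ (begin k - (u - k) ≡⟨ solve (k ∷ u ∷ []) ⟩ + 2 * k - u ∎) refl)

open import Data.Nat using (_+_; _*_; _/_; _>_)
open import Data.Integer using (_-_)

pos-4n+a+3b : ∀ n a b → + (4 * n + a + 3 * b) ≡ + 4 ℤ.* + n ℤ.+ + a ℤ.+ + 3 ℤ.* + b
pos-4n+a+3b n a b = begin
  + (4 * n) ℤ.+ + a ℤ.+ + (3 * b)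
    ≡⟨ cong₂ (λ s t → s ℤ.+ + a ℤ.+ t) (ℤ.pos-* 4 n) (ℤ.pos-* 3 b) ⟩
  + 4 ℤ.* + n ℤ.+ + a ℤ.+ + 3 ℤ.* + b ∎

Q-φ : ∀ a b v → Q a b (φ v) ≡ 4 * T a b v + a + 3 * b
Q-φ a b v = ℤ.+-injective (begin
  + Q a b (φ v)                                   ≡⟨ pos-Q a b (φ v) ⟩
  Qℤ (+ a) (+ b) (φ v)                            ≡⟨ Qℤ-φ (+ a) (+ b) v ⟩
  + 2 ℤ.* twiceTℤ (+ a) (+ b) v ℤ.+ + a ℤ.+ + 3 ℤ.* + b
    ≡⟨ cong (λ t → + 2 ℤ.* t ℤ.+ + a ℤ.+ + 3 ℤ.* + b) (twiceTℤ≡2T a b v) ⟩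
  + 2 ℤ.* (+ 2 ℤ.* + T a b v) ℤ.+ + a ℤ.+ + 3 ℤ.* + b
    ≡⟨ cong (λ t → t ℤ.+ + a ℤ.+ + 3 ℤ.* + b) (ℤ.*-assoc (+ 2) (+ 2) (+ T a b v)) ⟨
  + 4 ℤ.* + T a b v ℤ.+ + a ℤ.+ + 3 ℤ.* + b       ≡⟨ pos-4n+a+3b (T a b v) a b ⟨
  + (4 * T a b v + a + 3 * b)                     ∎)

Q-ψ : ∀ a b v → Q a b (ψ v) ≡ 2 * Q a b v
Q-ψ a b v = ℤ.+-injective (begin
  + Q a b (ψ v)        ≡⟨ pos-Q a b (ψ v) ⟩
  Qℤ (+ a) (+ b) (ψ v) ≡⟨ Qℤ-ψ (+ a) (+ b) v ⟩
  + 2 ℤ.* Qℤ (+ a) (+ b) v ≡⟨ cong (+ 2 ℤ.*_) (pos-Q a b v) ⟨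
  + 2 ℤ.* + Q a b v    ≡⟨ ℤ.pos-* 2 (Q a b v) ⟨
  + (2 * Q a b v)      ∎)

module _ {a b n m′ : ℕ} (0<a : a > 0) (0<b : b > 0) (b-odd : Oddℤ (+ b))
         (m≡2m′ : 4 * n + a + 3 * b ≡ 2 * m′) where

  private
    m : ℕ
    m = 4 * n + a + 3 * b

    Ms : List ℤ⁴
    Ms = solutions (Q a b) m m

    0<2b : 0 < 2 * b
    0<2b = ℕ.*-monoʳ-< 2 0<b

    0<4b : 0 < 4 * b
    0<4b = ℕ.*-monoʳ-< 4 0<b

    Q-solutions : ∀ k → Enumerates (λ v → Q a b v ≡ k) (solutions (Q a b) k k)
    Q-solutions k = solutions-enumerates λ {v} Qv≡k →
      subst (λ B → Bounded B v) Qv≡k (sqForm-bounded 0<a 0<a 0<b 0<2b v)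

    T-solutions : Enumerates (λ v → T a b v ≡ n) (solutions (T a b) (suc n) n)
    T-solutions = solutions-enumerates λ {v} Tv≡n →
      subst (λ B → Bounded (suc B) v) Tv≡n (triForm-bounded 0<a 0<a 0<2b 0<4b v)

    Qℤ≡4n+a+3b : ∀ w → Q a b w ≡ m → Qℤ (+ a) (+ b) w ≡ + 4 ℤ.* + n ℤ.+ + a ℤ.+ + 3 ℤ.* + b
    Qℤ≡4n+a+3b w Qw≡m = trans (sym (pos-Q a b w)) (trans (cong +_ Qw≡m) (pos-4n+a+3b n a b))

    Qℤ≡2m′ : ∀ w → Q a b w ≡ m → Qℤ (+ a) (+ b) w ≡ + 2 ℤ.* + m′
    Qℤ≡2m′ w Qw≡m = trans (sym (pos-Q a b w)) (trans (cong +_ (trans Qw≡m m≡2m′)) (ℤ.pos-* 2 m′))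

    φ-into : ∀ {w} → ∃[ v ] T a b v ≡ n × φ v ≡ w → Q a b w ≡ m × SumOdd w
    φ-into (v , Tv≡n , refl) = trans (Q-φ a b v) (cong (λ t → 4 * t + a + 3 * b) Tv≡n) , φ-sumOdd v

    φ-onto : ∀ {w} → Q a b w ≡ m × SumOdd w → ∃[ v ] T a b v ≡ n × φ v ≡ w
    φ-onto {u , v , z , w} (Qw≡m , u+v-odd) =
      let z-odd , w-odd = oddSum-forces-odd (+ a) (+ b) (+ n) u v z w b-odd
                            (Qℤ≡4n+a+3b (u , v , z , w) Qw≡m) u+v-odd
          p , φp≡w      = φ-preimage {u} {v} {z} {w} u+v-odd z-odd w-odd
      in p , cancel (trans (sym (Q-φ a b p)) (trans (cong (Q a b) φp≡w) Qw≡m)) , φp≡w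
      where
      cancel : ∀ {t} → 4 * t + a + 3 * b ≡ 4 * n + a + 3 * b → t ≡ n
      cancel {t} e = ℕ.*-cancelˡ-≡ t n 4 (ℕ.+-cancelʳ-≡ a _ _ (ℕ.+-cancelʳ-≡ (3 * b) _ _ e))

    ψ-into : ∀ {w} → ∃[ v ] Q a b v ≡ m′ × ψ v ≡ w → Q a b w ≡ m × ¬ SumOdd w
    ψ-into (v , Qv≡m′ , refl) = trans (Q-ψ a b v) (trans (cong (2 *_) Qv≡m′) (sym m≡2m′)) , ψ-¬sumOdd v

    ψ-onto : ∀ {w} → Q a b w ≡ m × ¬ SumOdd w → ∃[ v ] Q a b v ≡ m′ × ψ v ≡ w
    ψ-onto {u , v , z , w} (Qw≡m , ¬u+v-odd) =
      let u+v-even = ¬odd⇒even {u ℤ.+ v} ¬u+v-odd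
          z-even   = evenSum-forces-even (+ a) (+ b) (+ m′) u v z w b-odd
                       (Qℤ≡2m′ (u , v , z , w) Qw≡m) u+v-even
          p , ψp≡w = ψ-preimage {u} {v} {z} {w} u+v-even z-even
      in p , ℕ.*-cancelˡ-≡ (Q a b p) m′ 2
               (trans (sym (Q-ψ a b p)) (trans (cong (Q a b) ψp≡w) (trans Qw≡m m≡2m′)))
           , ψp≡w

  t4≡#oddSum : t4 a a (2 * b) (4 * b) n ≡ length (filter SumOdd? Ms)
  t4≡#oddSum = trans (sym (List.length-map φ (solutions (T a b) (suc n) n)))
    (enumerates-length (enumerates-map φ-injective T-solutions)
                       (enumerates-filter SumOdd? (Q-solutions m)) φ-into φ-onto)

  N4≡#evenSum : N4 a a b (2 * b) m′ ≡ length (filter (∁? SumOdd?) Ms)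
  N4≡#evenSum = trans (sym (List.length-map ψ (solutions (Q a b) m′ m′)))
    (enumerates-length (enumerates-map ψ-injective (Q-solutions m′))
                       (enumerates-filter (∁? SumOdd?) (Q-solutions m)) ψ-into ψ-onto)

  N4-split : N4 a a b (2 * b) (4 * n + a + 3 * b) ≡ t4 a a (2 * b) (4 * b) n + N4 a a b (2 * b) m′
  N4-split = begin
    N4 a a b (2 * b) m
      ≡⟨ length-filter-∁ SumOdd? Ms ⟩
    length (filter SumOdd? Ms) + length (filter (∁? SumOdd?) Ms)
      ≡⟨ cong₂ _+_ t4≡#oddSum N4≡#evenSum ⟨
    t4 a a (2 * b) (4 * b) n + N4 a a b (2 * b) m′ ∎

odd⇒oddℤ : ∀ {m} → Odd m → Oddℤ (+ m)
odd⇒oddℤ (k , refl) = + k , cong (ℤ._+ + 1) (ℤ.pos-* 2 k)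

4n+a+3b≡2*[2n+[a+3b]/2] : ∀ {a b} n → Odd a → Odd b → 4 * n + a + 3 * b ≡ 2 * (2 * n + (a + 3 * b) / 2)
4n+a+3b≡2*[2n+[a+3b]/2] n (i , refl) (j , refl) = begin
  4 * n + (2 * i + 1) + 3 * (2 * j + 1)           ≡⟨ solve (n ∷ i ∷ j ∷ []) ⟩
  2 * (2 * n + (i + 3 * j + 2))
    ≡⟨ cong (λ t → 2 * (2 * n + t)) (m*n/n≡m (i + 3 * j + 2) 2) ⟨
  2 * (2 * n + (i + 3 * j + 2) * 2 / 2)           ≡⟨ cong (λ t → 2 * (2 * n + t / 2)) a+3b≡ ⟩
  2 * (2 * n + (2 * i + 1 + 3 * (2 * j + 1)) / 2) ∎
  where
  open import Data.Nat.Tactic.RingSolver using (solve)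
  a+3b≡ : (i + 3 * j + 2) * 2 ≡ 2 * i + 1 + 3 * (2 * j + 1)
  a+3b≡ = solve (i ∷ j ∷ [])

+[m+n]-+n≡+m : ∀ m n → + (m + n) - + n ≡ + m
+[m+n]-+n≡+m m n = begin
  + m ℤ.+ + n - + n       ≡⟨ ℤ.+-assoc (+ m) (+ n) (ℤ.- + n) ⟩
  + m ℤ.+ (+ n - + n)     ≡⟨ cong (λ t → + m ℤ.+ t) (ℤ.+-inverseʳ (+ n)) ⟩
  + m ℤ.+ + 0             ≡⟨ ℤ.+-identityʳ (+ m) ⟩
  + m                     ∎

theorem5p9 : (a b n : ℕ) → a > 0 → b > 0 → n > 0 → Odd a → Odd b →
    + t4 a a (2 * b) (4 * b) n
      ≡ + N4 a a b (2 * b) (4 * n + a + 3 * b) - + N4 a a b (2 * b) (2 * n + (a + 3 * b) / 2)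
theorem5p9 a b n 0<a 0<b _ a-odd b-odd = begin
  + t                  ≡⟨ +[m+n]-+n≡+m t N′ ⟨
  + (t + N′) - + N′    ≡⟨ cong (λ k → + k - + N′) split ⟨
  + N - + N′           ∎
  where
  m′ = 2 * n + (a + 3 * b) / 2
  t  = t4 a a (2 * b) (4 * b) n
  N  = N4 a a b (2 * b) (4 * n + a + 3 * b)
  N′ = N4 a a b (2 * b) m′
  split : N ≡ t + N′
  split = N4-split 0<a 0<b (odd⇒oddℤ b-odd) (4n+a+3b≡2*[2n+[a+3b]/2] n a-odd b-odd)
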